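{- For every integer $m\geq1$, $$B_{2^m}=\bigcup_{k=0}^{2^m-1}E_{ -k}(2^mB_1),\qquad C_{2^m}=\bigcup_{k=0}^{2^m-1}E_{ -k}(2^mC_1),$$ i.e. $B_{2^m}=\{2^mb+k: b\in B_1,\ 0\le k\le 2^m-1\}$ and $C_{2^m}=\{2^mc+k: c\in C_1,\ 0\le k\le 2^m-1\}$.
   Context: $\mathbb{N}_0=\{0,1,2,\dots\}$. $t(n)$ is the Thue–Morse sequence: $t(n)=0$ if the binary expansion of $n$ has an even number of $1$'s, $t(n)=1$ otherwise. For $a\ge1$, $B_a=\{x\in\mathbb{N}_0: t(x+a)=1-t(x)\}$ and $C_a=\{x\in\mathbb{N}_0: t(x+a)=t(x)\}$. For a set of integers $A$ and $h\in\mathbb{Z}$, $E_h(A)=\{y-h: y\in A\}$, and for an integer $q$, $qA=\{qy:y\in A\}$. -}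

module Defs where

open import Data.Nat using (ℕ; zero; suc; _+_; _*_; _^_; _<_; _%_; _/_)
open import Data.Bool using (Bool; true; false; not; _xor_)
open import Data.Product using (Σ; _×_; ∃-syntax)
open import Relation.Binary.PropositionalEquality using (_≡_)

-- Parity of the number of 1's in the binary expansion of n, computed with
-- fuel; fuel f ≥ n suffices since n halves at every step.
parityBits : ℕ → ℕ → Bool
parityBits zero    n = false
parityBits (suc f) zero = false
parityBits (suc f) n@(suc _) = isOne (n % 2) xor parityBits f (n / 2)
  where
    isOne : ℕ → Bool
    isOne (suc zero) = true
    isOne _ = false

-- Thue–Morse sequence: t n = true  iff  n has an odd number of 1-bits
-- (true encodes 1, false encodes 0).
t : ℕ → Bool
t n = parityBits n n

B : ℕ → ℕ → Set
B a x = t (x + a) ≡ not (t x)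

C : ℕ → ℕ → Set
C a x = t (x + a) ≡ t x

InShiftedDilates : ℕ → (ℕ → Set) → ℕ → Set
InShiftedDilates q A x = ∃[ y ] ∃[ k ] (A y × k < q × x ≡ q * y + k)

module Submission where

-- Reading n in binary, the last m bits of  2^m * q + k  (k < 2^m)
-- are those of k and the remaining ones are those of q, so the bit parity
-- splits:  t (2^m * q + k) = t q xor t k  (the block lemma).  It follows by
-- induction on m from the one-digit recursion  t n = t (n / 2) xor t (n % 2),
-- which in turn is the definition of t once we know that the fuel of
-- parityBits is irrelevant.
--   Both B a and C a say that t changes by a fixed bit b between x and x + a,
-- i.e. that  jump a x = t (x + a) xor t x  equals b.  By the block lemma the
-- common summand t k cancels, so  jump (2^m) (2^m * y + k) = jump 1 y  for
-- k < 2^m: membership of 2^m * y + k in B (2^m) / C (2^m) only depends on the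
-- membership of y in B 1 / C 1.  Writing x = 2^m * (x / 2^m) + x % 2^m then
-- exhibits B (2^m) and C (2^m) as the required unions of shifted dilates.

open import Defs
open import Data.Nat using (ℕ; zero; suc; _+_; _*_; _^_; _≤_; _<_; _%_; _/_; z≤n; s≤s; NonZero)
open import Data.Nat.Properties
open import Data.Nat.DivMod
open import Data.Nat.Solver using (module +-*-Solver)
open import Data.Bool using (Bool; true; false; not; _xor_)
open import Data.Bool.Properties using (xor-assoc; xor-comm; xor-identityʳ; xor-same)
open import Data.Product using (_×_; _,_)
open import Function.Bundles using (_⇔_; mk⇔; Equivalence)
import Function.Properties.Equivalence as ⇔
open import Relation.Binary.PropositionalEquality

open +-*-Solver using (solve; _:+_; _:*_; _:=_; con)

xor-involutive : ∀ u v → (u xor v) xor v ≡ u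
xor-involutive u v = begin
  (u xor v) xor v   ≡⟨ xor-assoc u v v ⟩
  u xor (v xor v)   ≡⟨ cong (u xor_) (xor-same v) ⟩
  u xor false       ≡⟨ xor-identityʳ u ⟩
  u                 ∎
  where open ≡-Reasoning

xor-cancel-common : ∀ u v c → (u xor c) xor (v xor c) ≡ u xor v
xor-cancel-common u v c = begin
  (u xor c) xor (v xor c)   ≡⟨ xor-assoc u c (v xor c) ⟩
  u xor (c xor (v xor c))   ≡⟨ cong (u xor_) (xor-comm c (v xor c)) ⟩
  u xor ((v xor c) xor c)   ≡⟨ cong (u xor_) (xor-involutive v c) ⟩
  u xor v                   ∎
  where open ≡-Reasoning

xor-solve : ∀ u v b → (u ≡ b xor v) ⇔ (u xor v ≡ b)
xor-solve u v b = mk⇔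
  (λ u≡ → trans (cong (_xor v) u≡) (xor-involutive b v))
  (λ ≡b → sym (trans (cong (_xor v) (sym ≡b)) (xor-involutive u v)))

-- Halving strictly decreases a positive number; this is what makes any
-- fuel f ≥ n sufficient in parityBits.
half-decreases : ∀ n → suc n / 2 ≤ n
half-decreases n = ≤-pred (m/n<m (suc n) 2 (s≤s (s≤s z≤n)))

parityBits-fuel : ∀ f g n → n ≤ f → n ≤ g → parityBits f n ≡ parityBits g n
parityBits-fuel zero    zero    zero    _ _ = refl
parityBits-fuel zero    (suc g) zero    _ _ = refl
parityBits-fuel (suc f) zero    zero    _ _ = refl
parityBits-fuel (suc f) (suc g) zero    _ _ = refl
parityBits-fuel (suc f) (suc g) (suc n) (s≤s n≤f) (s≤s n≤g)
  with suc n % 2 | m%n<n (suc n) 2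
     | parityBits-fuel f g (suc n / 2) (≤-trans (half-decreases n) n≤f)
                                       (≤-trans (half-decreases n) n≤g)
... | 0           | _              | same = same
... | 1           | _              | same = cong not same
... | suc (suc _) | s≤s (s≤s ())   | _

t-digit : ∀ n → t n ≡ t (n / 2) xor t (n % 2)
t-digit zero = refl
t-digit (suc n)
  with suc n % 2 | m%n<n (suc n) 2
     | parityBits-fuel n (suc n / 2) (suc n / 2) (half-decreases n) ≤-refl
... | 0           | _              | same = trans same (sym (xor-identityʳ _))
... | 1           | _              | same = trans (cong not same) (xor-comm true _)
... | suc (suc _) | s≤s (s≤s ())   | _

half-shift : ∀ k p → (k + p * 2) / 2 ≡ k / 2 + p
half-shift k p = trans (+-distrib-/ k (p * 2) no-carry) (cong (k / 2 +_) (m*n/n≡m p 2))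
  where
  no-carry : k % 2 + p * 2 % 2 < 2
  no-carry = subst (λ r → k % 2 + r < 2) (sym (m*n%n≡0 p 2))
                   (subst (_< 2) (sym (+-identityʳ (k % 2))) (m%n<n k 2))

t-block : ∀ m q k → k < 2 ^ m → t (2 ^ m * q + k) ≡ t q xor t k
t-block zero q zero _ =
  trans (cong t (trans (+-identityʳ (1 * q)) (*-identityˡ q))) (sym (xor-identityʳ (t q)))
t-block zero q (suc k) (s≤s ())
t-block (suc m) q k k<2^[1+m] = begin
  t (2 ^ suc m * q + k)                 ≡⟨ cong t (low-bit-last m q k) ⟩
  t (k + (2 ^ m * q) * 2)               ≡⟨ t-digit (k + (2 ^ m * q) * 2) ⟩
  t ((k + (2 ^ m * q) * 2) / 2) xor t ((k + (2 ^ m * q) * 2) % 2)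
      ≡⟨ cong₂ (λ h r → t h xor t r) (half-shift k (2 ^ m * q)) ([m+kn]%n≡m%n k (2 ^ m * q) 2) ⟩
  t (k / 2 + 2 ^ m * q) xor t (k % 2)   ≡⟨ cong (λ h → t h xor t (k % 2)) (+-comm (k / 2) _) ⟩
  t (2 ^ m * q + k / 2) xor t (k % 2)   ≡⟨ cong (_xor t (k % 2)) (t-block m q (k / 2) k/2<2^m) ⟩
  (t q xor t (k / 2)) xor t (k % 2)     ≡⟨ xor-assoc (t q) _ _ ⟩
  t q xor (t (k / 2) xor t (k % 2))     ≡⟨ cong (t q xor_) (sym (t-digit k)) ⟩
  t q xor t k                           ∎
  where
  open ≡-Reasoning
  low-bit-last : ∀ m q k → 2 ^ suc m * q + k ≡ k + (2 ^ m * q) * 2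
  low-bit-last m q k = solve 3 (λ a q k → (con 2 :* a) :* q :+ k := k :+ (a :* q) :* con 2)
                               refl (2 ^ m) q k
  k/2<2^m : k / 2 < 2 ^ m
  k/2<2^m = m<n*o⇒m/o<n (subst (k <_) (*-comm 2 (2 ^ m)) k<2^[1+m])

jump : ℕ → ℕ → Bool
jump a x = t (x + a) xor t x

-- "t changes by the bit b between x and x + a"; B a and C a are the cases
-- b = true and b = false (definitionally, as true xor v = not v, false xor v = v).
Changes : Bool → ℕ → ℕ → Set
Changes b a x = t (x + a) ≡ b xor t x

changes⇔jump : ∀ b a x → Changes b a x ⇔ (jump a x ≡ b)
changes⇔jump b a x = xor-solve (t (x + a)) (t x) b

-- Within a block of length 2^m the jump by 2^m equals the jump by 1 of the
-- block index, because the common offset k cancels.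
jump-block : ∀ m y k → k < 2 ^ m → jump (2 ^ m) (2 ^ m * y + k) ≡ jump 1 y
jump-block m y k k<2^m = begin
  t (2 ^ m * y + k + 2 ^ m) xor t (2 ^ m * y + k)
      ≡⟨ cong (λ n → t n xor t (2 ^ m * y + k)) (next-block (2 ^ m) y k) ⟩
  t (2 ^ m * (y + 1) + k) xor t (2 ^ m * y + k)
      ≡⟨ cong₂ _xor_ (t-block m (y + 1) k k<2^m) (t-block m y k k<2^m) ⟩
  (t (y + 1) xor t k) xor (t y xor t k)
      ≡⟨ xor-cancel-common (t (y + 1)) (t y) (t k) ⟩
  t (y + 1) xor t y   ∎
  where
  open ≡-Reasoning
  next-block : ∀ a y k → a * y + k + a ≡ a * (y + 1) + k
  next-block = solve 3 (λ a y k → a :* y :+ k :+ a := a :* (y :+ con 1) :+ k) refl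

changes-block : ∀ b m y k → k < 2 ^ m → Changes b (2 ^ m) (2 ^ m * y + k) ⇔ Changes b 1 y
changes-block b m y k k<2^m =
  ⇔.trans (changes⇔jump b (2 ^ m) (2 ^ m * y + k))
  (⇔.trans (subst (λ j → (jump (2 ^ m) (2 ^ m * y + k) ≡ b) ⇔ (j ≡ b))
                  (jump-block m y k k<2^m) ⇔.refl)
           (⇔.sym (changes⇔jump b 1 y)))

shifted-dilates : ∀ q .{{_ : NonZero q}} (S A : ℕ → Set) →
  (∀ y k → k < q → S (q * y + k) ⇔ A y) → ∀ x → S x ⇔ InShiftedDilates q A x
shifted-dilates q S A block x = mk⇔
  (λ x∈S → x / q , x % q ,
           Equivalence.to (block (x / q) (x % q) (m%n<n x q)) (subst S x≡ x∈S) ,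
           m%n<n x q , x≡)
  (λ { (y , k , y∈A , k<q , refl) → Equivalence.from (block y k k<q) y∈A })
  where
  x≡ : x ≡ q * (x / q) + x % q
  x≡ = trans (m≡m%n+[m/n]*n x q) (trans (+-comm (x % q) _) (cong (_+ x % q) (*-comm (x / q) q)))

-- Theorem 5; the argument works for every m, so the hypothesis 1 ≤ m is unused.
theorem5 : (m : ℕ) → 1 ≤ m →
    ((x : ℕ) → B (2 ^ m) x ⇔ InShiftedDilates (2 ^ m) (B 1) x) ×
    ((x : ℕ) → C (2 ^ m) x ⇔ InShiftedDilates (2 ^ m) (C 1) x)
theorem5 m _ =
  shifted-dilates (2 ^ m) {{m^n≢0 2 m}} (B (2 ^ m)) (B 1) (changes-block true m) ,
  shifted-dilates (2 ^ m) {{m^n≢0 2 m}} (C (2 ^ m)) (C 1) (changes-block false m)
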